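{- Let $n\ge 2$. Let $B_{n,i}$ be the number of $w\in S_n$ with $cd(w)=i$, and let $A_{m,i}$ be the number of elements of $S_m$ with exactly $i-1$ descents. Then (1) as a polynomial identity in $x$, $\displaystyle x^{n-1}=\sum_{1\le i\le n-1}\frac{B_{n,i}}{n}\binom{n+x-i-1}{n-1}$; (2) $B_{n,i}=n\,A_{n-1,i}$ for all $i$.
   Context: For $w\in S_n$, a descent is an index $1\le i\le n-1$ with $w(i)>w(i+1)$; $d(w)$ is the number of descents. The cyclic descent number is $cd(w)=d(w)+1$ if $w(n)>w(1)$ and $cd(w)=d(w)$ otherwise. $\binom{y}{m}=y(y-1)\cdots(y-m+1)/m!$. -}

module Defs where

open import Data.Bool using (if_then_else_)
open import Data.Nat as ℕ using (ℕ; zero; suc; _<ᵇ_; _!)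
open import Data.Nat.Properties using (_!≢0)
open import Data.Fin using (Fin; toℕ)
open import Data.Integer using (+_)
open import Data.List using (List; []; _∷_; [_]; map; concatMap; filter; length; foldr; upTo; allFin)
open import Data.Vec using (Vec; toList) renaming ([] to []ᵥ; _∷_ to _∷ᵥ_)
open import Data.Rational as ℚ using (ℚ; 0ℚ; 1ℚ; _+_; _*_; _-_)
open import Data.List.Relation.Unary.Unique.DecPropositional using (unique?)
import Data.Fin.Properties as FinP
open import Relation.Nullary.Decidable using (does)

words : {A : Set} → List A → (k : ℕ) → List (Vec A k)
words xs zero = [ []ᵥ ]
words xs (suc k) = concatMap (λ a → map (a ∷ᵥ_) (words xs k)) xs

-- S_n: the permutations of {0,…,n-1}, in one-line notation w = w(1)…w(n)
-- (words of length n over Fin n with pairwise distinct letters).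
Sym : (n : ℕ) → List (Vec (Fin n) n)
Sym n = filter (λ w → unique? FinP._≟_ (toList w)) (words (allFin n) n)

desL : List ℕ → ℕ
desL (a ∷ b ∷ r) = (if b <ᵇ a then 1 else 0) ℕ.+ desL (b ∷ r)
desL _ = 0

lastOr : ℕ → List ℕ → ℕ
lastOr a [] = a
lastOr a (b ∷ r) = lastOr b r

wrapL : List ℕ → ℕ
wrapL [] = 0
wrapL (a ∷ r) = if a <ᵇ lastOr a r then 1 else 0

word : {n : ℕ} → Vec (Fin n) n → List ℕ
word w = map toℕ (toList w)

des : {n : ℕ} → Vec (Fin n) n → ℕ
des w = desL (word w)

cdes : {n : ℕ} → Vec (Fin n) n → ℕ
cdes w = desL (word w) ℕ.+ wrapL (word w)

B : ℕ → ℕ → ℕ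
B n i = length (filter (λ w → cdes w ℕ.≟ i) (Sym n))

-- A_{m,i} = #{w ∈ S_m : d(w) = i - 1}  (i.e. d(w) + 1 = i; so A_{m,0} = 0)
A : ℕ → ℕ → ℕ
A m i = length (filter (λ w → suc (des w) ℕ.≟ i) (Sym m))

_^ℚ_ : ℚ → ℕ → ℚ
x ^ℚ zero = 1ℚ
x ^ℚ suc k = x * (x ^ℚ k)

fromℕ : ℕ → ℚ
fromℕ k = + k ℚ./ 1

binom : ℚ → ℕ → ℚ
binom y m = foldr (λ j acc → (y - fromℕ j) * acc) 1ℚ (upTo m) * ((+ 1 ℚ./ (m !)) {{m !≢0}})

sumFrom1 : ℕ → (ℕ → ℚ) → ℚ
sumFrom1 m f = foldr (λ i acc → f i + acc) 0ℚ (map suc (upTo m))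

-- Every permutation of {0,…,m} is, in exactly one way, obtained from a permutation u
-- of {0,…,m−1} by inserting m into one of the m + 1 gaps of u, and also, in exactly
-- one way, as one of the m + 1 rotations of the word m u. Cyclic descents are
-- invariant under rotation and cd(m u) = d(u) + 1 for nonempty u, which gives
-- B(m+1, i) = (m+1) A(m, i). Inserting m into a word with k descents keeps k descents
-- in k + 1 gaps and creates one more in the other m − k; with this Eulerian recurrence
-- Σ_u binom(x + m − 1 − d(u), m) = x^m follows by induction on m (Worpitzky's
-- identity), and (1) is Worpitzky's identity rewritten with (2).

module Submission where

open import Defs
open import Data.Nat using (ℕ; _≤_; _∸_; NonZero) renaming (_*_ to _*ℕ_; _+_ to _+ℕ_)
open import Data.Integer using (+_)
open import Data.Rational using (ℚ; _*_; _+_; _-_; _/_)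
open import Data.Product using (_×_)
open import Relation.Binary.PropositionalEquality using (_≡_)

open import Data.Bool using (Bool; true; false; T; if_then_else_)
open import Data.Bool.Properties using (T-≡)
open import Data.Empty using (⊥-elim)
open import Data.Unit using (tt)
open import Data.Product using (Σ; _,_; proj₁; proj₂)
open import Function using (_∘_)
open import Function.Bundles using (Equivalence; mk⇔)
open import Relation.Nullary using (¬_; yes; no)
open import Relation.Binary.PropositionalEquality
  using (_≢_; refl; sym; trans; cong; cong₂; subst; setoid; module ≡-Reasoning)

open import Data.Nat as ℕ using (zero; suc; _<_; z≤n; s≤s; _<ᵇ_; _!)
import Data.Nat.Properties as ℕP
open import Data.Nat.Properties using (_!≢0)
import Data.Integer as ℤ
import Data.Integer.Properties as ℤP
open import Data.Rational using (0ℚ; 1ℚ)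
import Data.Rational.Properties as ℚP
open import Data.Rational.Unnormalised using (mkℚᵘ; *≡*)
import Data.Rational.Unnormalised.Properties as ℚᵘP
open import Data.Rational.Solver using (module +-*-Solver)
open +-*-Solver
open import Data.Fin using (Fin; toℕ; fromℕ<)
import Data.Fin.Properties as FinP
open import Data.Vec as V using (Vec; toList)
import Data.Vec.Properties as VP

open import Data.List using (List; []; _∷_; [_]; length; take; drop; _++_; map; concatMap; filter; foldr; upTo; allFin)
import Data.List.Properties as LP
open import Data.List.Relation.Unary.Any using (here; there)
open import Data.List.Relation.Unary.All as All using (All; []; _∷_)
import Data.List.Relation.Unary.All.Properties as AllP
open import Data.List.Relation.Unary.Unique.Propositional using (Unique; []; _∷_)
import Data.List.Relation.Unary.Unique.Propositional.Properties as UniqueP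
open import Data.List.Membership.Propositional using (_∈_; _∉_; find; lose)
open import Data.List.Membership.Propositional.Properties
open import Data.List.Membership.Propositional.Properties.WithK using (unique∧set⇒bag)
open import Data.List.Membership.DecPropositional ℕ._≟_ using (_∈?_)
open import Data.List.Relation.Binary.Permutation.Propositional as Perm
  using (_↭_; ↭-sym; ↭-trans; ↭-refl; ↭-reflexive)
import Data.List.Relation.Binary.Permutation.Propositional.Properties as PermP
import Data.List.Relation.Binary.Permutation.Setoid.Properties as PermSetoidP
open import Data.List.Relation.Binary.BagAndSetEquality using (∼bag⇒↭)

fromℕ-suc : ∀ k → fromℕ (suc k) ≡ 1ℚ + fromℕ k
fromℕ-suc k = ℚP.toℚᵘ-injective (ℚᵘP.≃-trans (ℚP.toℚᵘ-fromℚᵘ (mkℚᵘ (+ suc k) 0))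
  (ℚᵘP.≃-sym (ℚᵘP.≃-trans (ℚP.toℚᵘ-homo-+ 1ℚ (fromℕ k))
    (ℚᵘP.≃-trans (ℚᵘP.+-congʳ (mkℚᵘ (+ 1) 0) (ℚP.toℚᵘ-fromℚᵘ (mkℚᵘ (+ k) 0)))
      (*≡* (cong (ℤ._* + 1) (cong (ℤ._+_ (+ 1)) (ℤP.*-identityʳ (+ k)))))))))

fromℕ-+ : ∀ a b → fromℕ (a +ℕ b) ≡ fromℕ a + fromℕ b
fromℕ-+ zero b = sym (ℚP.+-identityˡ (fromℕ b))
fromℕ-+ (suc a) b = begin
  fromℕ (suc (a +ℕ b))        ≡⟨ fromℕ-suc (a +ℕ b) ⟩
  1ℚ + fromℕ (a +ℕ b)         ≡⟨ cong (_+_ 1ℚ) (fromℕ-+ a b) ⟩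
  1ℚ + (fromℕ a + fromℕ b)    ≡⟨ ℚP.+-assoc 1ℚ (fromℕ a) (fromℕ b) ⟨
  1ℚ + fromℕ a + fromℕ b      ≡⟨ cong (_+ fromℕ b) (fromℕ-suc a) ⟨
  fromℕ (suc a) + fromℕ b     ∎
  where open ≡-Reasoning

fromℕ-* : ∀ a b → fromℕ (a *ℕ b) ≡ fromℕ a * fromℕ b
fromℕ-* zero b = sym (ℚP.*-zeroˡ (fromℕ b))
fromℕ-* (suc a) b = begin
  fromℕ (b +ℕ a *ℕ b)            ≡⟨ fromℕ-+ b (a *ℕ b) ⟩
  fromℕ b + fromℕ (a *ℕ b)       ≡⟨ cong (_+_ (fromℕ b)) (fromℕ-* a b) ⟩
  fromℕ b + fromℕ a * fromℕ b    ≡⟨ solve 2 (λ b a → b :+ a :* b := (con 1ℚ :+ a) :* b) refl (fromℕ b) (fromℕ a) ⟩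
  (1ℚ + fromℕ a) * fromℕ b       ≡⟨ cong (_* fromℕ b) (fromℕ-suc a) ⟨
  fromℕ (suc a) * fromℕ b        ∎
  where open ≡-Reasoning

fromℕ-∸ : ∀ {a b} → b ≤ a → fromℕ (a ∸ b) ≡ fromℕ a - fromℕ b
fromℕ-∸ {a} {b} b≤a = begin
  fromℕ (a ∸ b)                          ≡⟨ solve 2 (λ d b → d := (b :+ d) :- b) refl (fromℕ (a ∸ b)) (fromℕ b) ⟩
  (fromℕ b + fromℕ (a ∸ b)) - fromℕ b    ≡⟨ cong (_- fromℕ b) (fromℕ-+ b (a ∸ b)) ⟨
  fromℕ (b +ℕ (a ∸ b)) - fromℕ b         ≡⟨ cong (λ c → fromℕ c - fromℕ b) (ℕP.m+[n∸m]≡n b≤a) ⟩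
  fromℕ a - fromℕ b                      ∎
  where open ≡-Reasoning

fromℕ-*-inverseʳ : ∀ k .{{_ : NonZero k}} → fromℕ k * (+ 1 / k) ≡ 1ℚ
fromℕ-*-inverseʳ (suc k) = ℚP.toℚᵘ-injective (ℚᵘP.≃-trans (ℚP.toℚᵘ-homo-* (fromℕ (suc k)) (+ 1 / suc k))
  (ℚᵘP.≃-trans (ℚᵘP.*-cong (ℚP.toℚᵘ-fromℚᵘ (mkℚᵘ (+ suc k) 0)) (ℚP.toℚᵘ-fromℚᵘ (mkℚᵘ (+ 1) k)))
    (*≡* (trans (ℤP.*-identityʳ _) (trans (ℤP.*-identityʳ _)
      (sym (trans (ℤP.*-identityˡ _) (cong +_ (ℕP.*-identityˡ (suc k))))))))))

[n*a]/n≡fromℕ-a : ∀ n a .{{_ : NonZero n}} → + (n *ℕ a) / n ≡ fromℕ a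
[n*a]/n≡fromℕ-a (suc n) a = ℚP.toℚᵘ-injective (ℚᵘP.≃-trans (ℚP.toℚᵘ-fromℚᵘ (mkℚᵘ (+ (suc n *ℕ a)) n))
  (ℚᵘP.≃-sym (ℚᵘP.≃-trans (ℚP.toℚᵘ-fromℚᵘ (mkℚᵘ (+ a) 0))
    (*≡* (trans (sym (ℤP.pos-* a (suc n))) (trans (cong +_ (ℕP.*-comm a (suc n))) (sym (ℤP.*-identityʳ _))))))))

private variable
  X Y : Set

∑ : (X → ℚ) → List X → ℚ
∑ f = foldr (λ x acc → f x + acc) 0ℚ

∑-++ : ∀ (f : X → ℚ) xs ys → ∑ f (xs ++ ys) ≡ ∑ f xs + ∑ f ys
∑-++ f [] ys = sym (ℚP.+-identityˡ _)
∑-++ f (x ∷ xs) ys = trans (cong (_+_ (f x)) (∑-++ f xs ys)) (sym (ℚP.+-assoc (f x) _ _))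

∑-map : ∀ (f : Y → ℚ) (g : X → Y) xs → ∑ f (map g xs) ≡ ∑ (f ∘ g) xs
∑-map f g [] = refl
∑-map f g (x ∷ xs) = cong (_+_ (f (g x))) (∑-map f g xs)

∑-concatMap : ∀ (f : Y → ℚ) (g : X → List Y) xs → ∑ f (concatMap g xs) ≡ ∑ (∑ f ∘ g) xs
∑-concatMap f g [] = refl
∑-concatMap f g (x ∷ xs) = trans (∑-++ f (g x) (concatMap g xs)) (cong (_+_ (∑ f (g x))) (∑-concatMap f g xs))

∑-cong : ∀ {f g : X → ℚ} xs → (∀ {x} → x ∈ xs → f x ≡ g x) → ∑ f xs ≡ ∑ g xs
∑-cong [] f≡g = refl
∑-cong (x ∷ xs) f≡g = cong₂ _+_ (f≡g (here refl)) (∑-cong xs (f≡g ∘ there))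

∑-zero : ∀ {f : X → ℚ} xs → (∀ {x} → x ∈ xs → f x ≡ 0ℚ) → ∑ f xs ≡ 0ℚ
∑-zero [] f≡0 = refl
∑-zero (x ∷ xs) f≡0 = cong₂ _+_ (f≡0 (here refl)) (∑-zero xs (f≡0 ∘ there))

∑-+ : ∀ (f g : X → ℚ) xs → ∑ (λ x → f x + g x) xs ≡ ∑ f xs + ∑ g xs
∑-+ f g [] = refl
∑-+ f g (x ∷ xs) = trans (cong (_+_ (f x + g x)) (∑-+ f g xs))
  (solve 4 (λ a b c d → (a :+ b) :+ (c :+ d) := (a :+ c) :+ (b :+ d)) refl (f x) (g x) (∑ f xs) (∑ g xs))

∑-*ˡ : ∀ (f : X → ℚ) c xs → c * ∑ f xs ≡ ∑ (λ x → c * f x) xs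
∑-*ˡ f c [] = ℚP.*-zeroʳ c
∑-*ˡ f c (x ∷ xs) = trans (ℚP.*-distribˡ-+ c (f x) (∑ f xs)) (cong (_+_ (c * f x)) (∑-*ˡ f c xs))

∑-*ʳ : ∀ (f : X → ℚ) c xs → ∑ f xs * c ≡ ∑ (λ x → f x * c) xs
∑-*ʳ f c [] = ℚP.*-zeroˡ c
∑-*ʳ f c (x ∷ xs) = trans (ℚP.*-distribʳ-+ c (f x) (∑ f xs)) (cong (_+_ (f x * c)) (∑-*ʳ f c xs))

∑-↭ : ∀ (f : X → ℚ) {xs ys} → xs ↭ ys → ∑ f xs ≡ ∑ f ys
∑-↭ f Perm.refl = refl
∑-↭ f (Perm.prep x p) = cong (_+_ (f x)) (∑-↭ f p)
∑-↭ f {_} {_ ∷ _ ∷ ys} (Perm.swap x y p) = trans (cong (λ s → f x + (f y + s)) (∑-↭ f p))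
  (solve 3 (λ a b c → a :+ (b :+ c) := b :+ (a :+ c)) refl (f x) (f y) (∑ f ys))
∑-↭ f (Perm.trans p q) = trans (∑-↭ f p) (∑-↭ f q)

∑-upTo-suc : ∀ (f : ℕ → ℚ) n → ∑ f (upTo (suc n)) ≡ f 0 + ∑ (f ∘ suc) (upTo n)
∑-upTo-suc f n = cong (_+_ (f 0)) (trans (cong (∑ f) (sym (LP.map-upTo suc n))) (∑-map f suc (upTo n)))

∏-sub : ℚ → List ℕ → ℚ
∏-sub y = foldr (λ j acc → (y - fromℕ j) * acc) 1ℚ

infix 8 _^↓_

_^↓_ : ℚ → ℕ → ℚ
y ^↓ m = ∏-sub y (upTo m)

∏-sub-map-suc : ∀ y js → ∏-sub y (map suc js) ≡ ∏-sub (y - 1ℚ) js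
∏-sub-map-suc y [] = refl
∏-sub-map-suc y (j ∷ js) = cong₂ _*_ y-[1+j]≡y-1-j (∏-sub-map-suc y js)
  where
  y-[1+j]≡y-1-j : y - fromℕ (suc j) ≡ (y - 1ℚ) - fromℕ j
  y-[1+j]≡y-1-j = trans (cong (y -_) (fromℕ-suc j))
    (solve 2 (λ y j → y :- (con 1ℚ :+ j) := (y :- con 1ℚ) :- j) refl y (fromℕ j))

^↓-suc : ∀ y m → y ^↓ suc m ≡ y * (y - 1ℚ) ^↓ m
^↓-suc y m = cong₂ _*_ (solve 1 (λ y → y :- con 0ℚ := y) refl y)
  (trans (cong (∏-sub y) (sym (LP.map-upTo suc m))) (∏-sub-map-suc y (upTo m)))

^↓-sucʳ : ∀ y m → y ^↓ suc m ≡ y ^↓ m * (y - fromℕ m)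
^↓-sucʳ y zero = ℚP.*-comm (y - fromℕ 0) 1ℚ
^↓-sucʳ y (suc m) = begin
  y ^↓ suc (suc m)                               ≡⟨ ^↓-suc y (suc m) ⟩
  y * (y - 1ℚ) ^↓ suc m                          ≡⟨ cong (y *_) (^↓-sucʳ (y - 1ℚ) m) ⟩
  y * ((y - 1ℚ) ^↓ m * ((y - 1ℚ) - fromℕ m))     ≡⟨ cong (λ z → y * ((y - 1ℚ) ^↓ m * z)) y-1-m≡y-[1+m] ⟩
  y * ((y - 1ℚ) ^↓ m * (y - fromℕ (suc m)))      ≡⟨ ℚP.*-assoc y _ _ ⟨
  y * (y - 1ℚ) ^↓ m * (y - fromℕ (suc m))        ≡⟨ cong (_* (y - fromℕ (suc m))) (^↓-suc y m) ⟨
  y ^↓ suc m * (y - fromℕ (suc m))               ∎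
  where
  open ≡-Reasoning
  y-1-m≡y-[1+m] : (y - 1ℚ) - fromℕ m ≡ y - fromℕ (suc m)
  y-1-m≡y-[1+m] = trans (solve 2 (λ y m → (y :- con 1ℚ) :- m := y :- (con 1ℚ :+ m)) refl y (fromℕ m))
    (cong (y -_) (sym (fromℕ-suc m)))

𝟙 : Bool → ℕ
𝟙 b = if b then 1 else 0

𝟙≤1 : ∀ b → 𝟙 b ≤ 1
𝟙≤1 true = s≤s z≤n
𝟙≤1 false = z≤n

<⇒<ᵇ≡true : ∀ {m n} → m < n → (m <ᵇ n) ≡ true
<⇒<ᵇ≡true m<n = Equivalence.to T-≡ (ℕP.<⇒<ᵇ m<n)

>⇒<ᵇ≡false : ∀ {m n} → n < m → (m <ᵇ n) ≡ false
>⇒<ᵇ≡false {m} {n} n<m with m <ᵇ n in eq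
... | false = refl
... | true = ⊥-elim (ℕP.<-asym n<m (ℕP.<ᵇ⇒< m n (subst T (sym eq) tt)))

desL-∷-≤ : ∀ a r → desL (a ∷ r) ≤ length r
desL-∷-≤ a [] = z≤n
desL-∷-≤ a (b ∷ r) = ℕP.+-mono-≤ (𝟙≤1 (b <ᵇ a)) (desL-∷-≤ b r)

desL-≤ : ∀ u → desL u ≤ length u
desL-≤ [] = z≤n
desL-≤ (a ∷ r) = ℕP.m≤n⇒m≤1+n (desL-∷-≤ a r)

insertAt : ℕ → ℕ → List ℕ → List ℕ
insertAt j M u = take j u ++ M ∷ drop j u

-- Inserting a new maximum into a word of length L with k descents: the k + 1 slots
-- after a descent top or at the end keep k descents, the other L − k slots add one.
eulerSplit : (ℕ → ℚ) → ℕ → ℕ → ℚ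
eulerSplit g k L = fromℕ (suc k) * g k + fromℕ (L ∸ k) * g (suc k)

eulerSplit-ascent : ∀ g k L → k ≤ L → g (suc k) + eulerSplit g k L ≡ eulerSplit g k (suc L)
eulerSplit-ascent g k L k≤L = begin
  g (suc k) + (fromℕ (suc k) * g k + fromℕ (L ∸ k) * g (suc k))
    ≡⟨ solve 4 (λ a b c d → a :+ (b :* c :+ d :* a) := b :* c :+ (con 1ℚ :+ d) :* a) refl
         (g (suc k)) (fromℕ (suc k)) (g k) (fromℕ (L ∸ k)) ⟩
  fromℕ (suc k) * g k + (1ℚ + fromℕ (L ∸ k)) * g (suc k)
    ≡⟨ cong (λ c → fromℕ (suc k) * g k + c * g (suc k))
         (sym (trans (cong fromℕ (ℕP.+-∸-assoc 1 k≤L)) (fromℕ-suc (L ∸ k)))) ⟩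
  fromℕ (suc k) * g k + fromℕ (suc L ∸ k) * g (suc k) ∎
  where open ≡-Reasoning

eulerSplit-descent : ∀ g k L → g (suc k) + eulerSplit (g ∘ suc) k L ≡ eulerSplit g (suc k) (suc L)
eulerSplit-descent g k L = begin
  g (suc k) + (fromℕ (suc k) * g (suc k) + fromℕ (L ∸ k) * g (suc (suc k)))
    ≡⟨ solve 4 (λ a b d c → a :+ (b :* a :+ d :* c) := (con 1ℚ :+ b) :* a :+ d :* c) refl
         (g (suc k)) (fromℕ (suc k)) (fromℕ (L ∸ k)) (g (suc (suc k))) ⟩
  (1ℚ + fromℕ (suc k)) * g (suc k) + fromℕ (L ∸ k) * g (suc (suc k))
    ≡⟨ cong (λ c → c * g (suc k) + fromℕ (L ∸ k) * g (suc (suc k))) (sym (fromℕ-suc (suc k))) ⟩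
  eulerSplit g (suc k) (suc L) ∎
  where open ≡-Reasoning

∑-insertAt-desL-∷ : ∀ g M a r → a < M → All (_< M) r →
  ∑ (λ j → g (desL (a ∷ insertAt j M r))) (upTo (suc (length r))) ≡ eulerSplit g (desL (a ∷ r)) (length r)
∑-insertAt-desL-∷ g M a [] a<M [] rewrite >⇒<ᵇ≡false a<M =
  solve 2 (λ x y → x :+ con 0ℚ := con 1ℚ :* x :+ con 0ℚ :* y) refl (g 0) (g 1)
∑-insertAt-desL-∷ g M a (b ∷ r) a<M (b<M ∷ r<M)
  rewrite ∑-upTo-suc (λ j → g (desL (a ∷ insertAt j M (b ∷ r)))) (suc (length r))
        | >⇒<ᵇ≡false a<M | <⇒<ᵇ≡true b<M
  with b <ᵇ a
... | false = trans (cong (_+_ (g (suc (desL (b ∷ r))))) (∑-insertAt-desL-∷ g M b r b<M r<M))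
                    (eulerSplit-ascent g (desL (b ∷ r)) (length r) (desL-∷-≤ b r))
... | true = trans (cong (_+_ (g (suc (desL (b ∷ r))))) (∑-insertAt-desL-∷ (g ∘ suc) M b r b<M r<M))
                   (eulerSplit-descent g (desL (b ∷ r)) (length r))

∑-insertAt-desL : ∀ g M u → All (_< M) u →
  ∑ (λ j → g (desL (insertAt j M u))) (upTo (suc (length u))) ≡ eulerSplit g (desL u) (length u)
∑-insertAt-desL g M [] [] = solve 2 (λ x y → x :+ con 0ℚ := con 1ℚ :* x :+ con 0ℚ :* y) refl (g 0) (g 1)
∑-insertAt-desL g M (b ∷ r) (b<M ∷ r<M)
  rewrite ∑-upTo-suc (λ j → g (desL (insertAt j M (b ∷ r)))) (suc (length r)) | <⇒<ᵇ≡true b<M =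
  trans (cong (_+_ (g (suc (desL (b ∷ r))))) (∑-insertAt-desL-∷ g M b r b<M r<M))
        (eulerSplit-ascent g (desL (b ∷ r)) (length r) (desL-∷-≤ b r))

worpitzkyArg : ℚ → ℕ → ℕ → ℚ
worpitzkyArg x n i = fromℕ n + x - fromℕ i - fromℕ 1

-- With y = x + m − k − 1, both (y + 1)↓(m+1) and y↓(m+1) contain the factor y↓m, and
-- (k + 1)(y + 1) + (m − k)(y − m) = (m + 1) x.
eulerSplit-worpitzky : ∀ x m k → k ≤ m →
  eulerSplit (λ t → worpitzkyArg x (suc (suc m)) (suc t) ^↓ suc m) k m
    ≡ fromℕ (suc m) * x * worpitzkyArg x (suc m) (suc k) ^↓ m
eulerSplit-worpitzky x m k k≤m = begin
  fromℕ (suc k) * worpitzkyArg x (2 +ℕ m) (suc k) ^↓ suc m + fromℕ (m ∸ k) * worpitzkyArg x (2 +ℕ m) (2 +ℕ k) ^↓ suc m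
    ≡⟨ cong₂ (λ a b → fromℕ (suc k) * a ^↓ suc m + fromℕ (m ∸ k) * b ^↓ suc m) arg-k arg-suc-k ⟩
  fromℕ (suc k) * (y + 1ℚ) ^↓ suc m + fromℕ (m ∸ k) * y ^↓ suc m
    ≡⟨ cong₂ (λ a b → fromℕ (suc k) * a + fromℕ (m ∸ k) * b) [y+1]^↓suc-m (^↓-sucʳ y m) ⟩
  fromℕ (suc k) * ((y + 1ℚ) * y ^↓ m) + fromℕ (m ∸ k) * (y ^↓ m * (y - fromℕ m))
    ≡⟨ cong₂ (λ a b → φ a b (fromℕ (m ∸ k))) (fromℕ-suc k) (fromℕ-suc m) ⟩
  φ (1ℚ + fromℕ k) (1ℚ + fromℕ m) (fromℕ (m ∸ k))
    ≡⟨ cong (φ (1ℚ + fromℕ k) (1ℚ + fromℕ m)) (fromℕ-∸ k≤m) ⟩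
  φ (1ℚ + fromℕ k) (1ℚ + fromℕ m) (fromℕ m - fromℕ k)
    ≡⟨ solve 4 (λ x m k f → (con 1ℚ :+ k) :* (((((con 1ℚ :+ m) :+ x :- (con 1ℚ :+ k)) :- con 1ℚ) :+ con 1ℚ) :* f)
                            :+ (m :- k) :* (f :* ((((con 1ℚ :+ m) :+ x :- (con 1ℚ :+ k)) :- con 1ℚ) :- m))
                          := (con 1ℚ :+ m) :* x :* f) refl x (fromℕ m) (fromℕ k) (y ^↓ m) ⟩
  (1ℚ + fromℕ m) * x * y ^↓ m
    ≡⟨ cong (λ c → c * x * y ^↓ m) (sym (fromℕ-suc m)) ⟩
  fromℕ (suc m) * x * y ^↓ m ∎
  where
  open ≡-Reasoning
  y = worpitzkyArg x (suc m) (suc k)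
  φ : ℚ → ℚ → ℚ → ℚ
  φ 1+k 1+m d = 1+k * (((1+m + x - 1+k - 1ℚ) + 1ℚ) * y ^↓ m) + d * (y ^↓ m * ((1+m + x - 1+k - 1ℚ) - fromℕ m))
  arg-k : worpitzkyArg x (2 +ℕ m) (suc k) ≡ y + 1ℚ
  arg-k = trans (cong (λ c → c + x - fromℕ (suc k) - 1ℚ) (fromℕ-suc (suc m)))
    (solve 3 (λ a x b → (con 1ℚ :+ a) :+ x :- b :- con 1ℚ := (a :+ x :- b :- con 1ℚ) :+ con 1ℚ) refl
      (fromℕ (suc m)) x (fromℕ (suc k)))
  arg-suc-k : worpitzkyArg x (2 +ℕ m) (2 +ℕ k) ≡ y
  arg-suc-k = trans (cong₂ (λ a b → a + x - b - 1ℚ) (fromℕ-suc (suc m)) (fromℕ-suc (suc k)))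
    (solve 3 (λ a x b → (con 1ℚ :+ a) :+ x :- (con 1ℚ :+ b) :- con 1ℚ := a :+ x :- b :- con 1ℚ) refl
      (fromℕ (suc m)) x (fromℕ (suc k)))
  [y+1]^↓suc-m : (y + 1ℚ) ^↓ suc m ≡ (y + 1ℚ) * y ^↓ m
  [y+1]^↓suc-m = trans (^↓-suc (y + 1ℚ) m)
    (cong (λ z → (y + 1ℚ) * z ^↓ m) (solve 1 (λ y → y :+ con 1ℚ :- con 1ℚ := y) refl y))

Unique-resp-↭ : ∀ {xs ys : List X} → xs ↭ ys → Unique xs → Unique ys
Unique-resp-↭ {X = X} p = PermSetoidP.Unique-resp-↭ (setoid X) (Perm.↭⇒↭ₛ p)

Unique-map-injectiveOn : ∀ (f : X → Y) {xs} → (∀ {x y} → x ∈ xs → y ∈ xs → f x ≡ f y → x ≡ y) →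
  Unique xs → Unique (map f xs)
Unique-map-injectiveOn f {[]} inj [] = []
Unique-map-injectiveOn f {x ∷ xs} inj (x∉xs ∷ u) =
  AllP.map⁺ (All.tabulate (λ {y} y∈ fx≡fy → All.lookup x∉xs y∈ (inj (here refl) (there y∈) fx≡fy)))
  ∷ Unique-map-injectiveOn f (λ p q → inj (there p) (there q)) u

Unique-concatMap : ∀ (f : X → List Y) {xs} → Unique xs → (∀ {x} → x ∈ xs → Unique (f x)) →
  (∀ {x y z} → x ∈ xs → y ∈ xs → z ∈ f x → z ∈ f y → x ≡ y) → Unique (concatMap f xs)
Unique-concatMap f {[]} _ _ _ = []
Unique-concatMap f {x ∷ xs} (x∉xs ∷ u) fu disjoint =
  UniqueP.++⁺ (fu (here refl)) (Unique-concatMap f u (fu ∘ there) (λ p q → disjoint (there p) (there q))) apart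
  where
  apart : ∀ {v} → ¬ (v ∈ f x × v ∈ concatMap f xs)
  apart (v∈fx , v∈rest) with find (∈-concatMap⁻ f {xs = xs} v∈rest)
  ... | y , y∈ , v∈fy = All.lookup x∉xs y∈ (disjoint (here refl) (there y∈) v∈fx v∈fy)

++-∷-injective : ∀ {M : X} p p' {s s'} → M ∉ p → M ∉ p' → p ++ M ∷ s ≡ p' ++ M ∷ s' → p ≡ p' × s ≡ s'
++-∷-injective [] [] _ _ eq = refl , LP.∷-injectiveʳ eq
++-∷-injective [] (b ∷ p') _ M∉p' eq = ⊥-elim (M∉p' (here (LP.∷-injectiveˡ eq)))
++-∷-injective (a ∷ p) [] M∉p _ eq = ⊥-elim (M∉p (here (sym (LP.∷-injectiveˡ eq))))
++-∷-injective (a ∷ p) (b ∷ p') M∉p M∉p' eq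
  with LP.∷-injectiveˡ eq | ++-∷-injective p p' (M∉p ∘ there) (M∉p' ∘ there) (LP.∷-injectiveʳ eq)
... | refl | refl , s≡s' = refl , s≡s'

<-All⇒∉ : ∀ {m u} → All (_< m) u → m ∉ u
<-All⇒∉ u<m m∈u = ℕP.<-irrefl refl (All.lookup u<m m∈u)

<suc∧≢⇒< : ∀ {y k} → y < suc k → y ≢ k → y < k
<suc∧≢⇒< (s≤s y≤k) y≢k = ℕP.≤∧≢⇒< y≤k y≢k

-- Pigeonhole: in the tail l, replacing the value k by the head x (which is not in l)
-- keeps l duplicate-free and brings all its values below k.
Unique∧All<⇒length≤ : ∀ k l → Unique l → All (_< k) l → length l ≤ k
Unique∧All<⇒length≤ k [] _ _ = z≤n
Unique∧All<⇒length≤ zero (x ∷ l) _ (() ∷ _)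
Unique∧All<⇒length≤ (suc k) (x ∷ l) (x∉l ∷ u) (x<1+k ∷ l<1+k) with x ℕ.≟ k
... | yes refl = s≤s (Unique∧All<⇒length≤ k l u
      (All.tabulate (λ y∈ → <suc∧≢⇒< (All.lookup l<1+k y∈) (λ y≡x → All.lookup x∉l y∈ (sym y≡x)))))
... | no x≢k = s≤s (subst (_≤ k) (LP.length-map σ l)
      (Unique∧All<⇒length≤ k (map σ l) (Unique-map-injectiveOn σ σ-injectiveOn u) σl<k))
  where
  σ : ℕ → ℕ
  σ y with y ℕ.≟ k
  ... | yes _ = x
  ... | no _ = y
  σ-injectiveOn : ∀ {y y'} → y ∈ l → y' ∈ l → σ y ≡ σ y' → y ≡ y'
  σ-injectiveOn {y} {y'} p q eq with y ℕ.≟ k | y' ℕ.≟ k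
  ... | yes y≡k | yes y'≡k = trans y≡k (sym y'≡k)
  ... | yes _ | no _ = ⊥-elim (All.lookup x∉l q eq)
  ... | no _ | yes _ = ⊥-elim (All.lookup x∉l p (sym eq))
  ... | no _ | no _ = eq
  σ<k : ∀ y → y < suc k → σ y < k
  σ<k y y<1+k with y ℕ.≟ k
  ... | yes _ = <suc∧≢⇒< x<1+k x≢k
  ... | no y≢k = <suc∧≢⇒< y<1+k y≢k
  σl<k : All (_< k) (map σ l)
  σl<k = AllP.map⁺ (All.tabulate (λ {y} y∈ → σ<k y (All.lookup l<1+k y∈)))

words-unique : ∀ {xs : List X} k → Unique xs → Unique (words xs k)
words-unique zero _ = [] ∷ []
words-unique {xs = xs} (suc k) u =
  Unique-concatMap (λ a → map (a V.∷_) (words xs k)) u (λ _ → UniqueP.map⁺ VP.∷-injectiveʳ (words-unique k u)) disjoint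
  where
  disjoint : ∀ {x y z} → x ∈ xs → y ∈ xs → z ∈ map (x V.∷_) (words xs k) → z ∈ map (y V.∷_) (words xs k) → x ≡ y
  disjoint _ _ p q with ∈-map⁻ _ p | ∈-map⁻ _ q
  ... | _ , _ , z≡x∷v | _ , _ , z≡y∷v' = VP.∷-injectiveˡ (trans (sym z≡x∷v) z≡y∷v')

∈-words : ∀ {xs : List X} → (∀ a → a ∈ xs) → ∀ {k} (v : Vec X k) → v ∈ words xs k
∈-words all∈ V.[] = here refl
∈-words {xs = xs} all∈ {suc k} (a V.∷ v) =
  ∈-concatMap⁺ (λ a → map (a V.∷_) (words xs k)) (lose (all∈ a) (∈-map⁺ (a V.∷_) (∈-words all∈ v)))

word-injective : ∀ {m} {v v' : Vec (Fin m) m} → word v ≡ word v' → v ≡ v'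
word-injective {v = v} {v'} eq =
  trans (sym (VP.cast-is-id refl v)) (VP.toList-injective refl v v' (LP.map-injective FinP.toℕ-injective eq))

perms : ℕ → List (List ℕ)
perms m = map word (Sym m)

IsPerm : ℕ → List ℕ → Set
IsPerm m l = length l ≡ m × All (_< m) l × Unique l

IsPerm-resp-↭ : ∀ {m xs ys} → xs ↭ ys → IsPerm m xs → IsPerm m ys
IsPerm-resp-↭ p (len , bounded , u) =
  trans (sym (PermP.↭-length p)) len , PermP.All-resp-↭ p bounded , Unique-resp-↭ p u

IsPerm-∷ : ∀ {m u} → IsPerm m u → IsPerm (suc m) (m ∷ u)
IsPerm-∷ {m} {u} (len , u<m , uu) =
  cong suc len , (ℕP.n<1+n m ∷ All.map ℕP.m<n⇒m<1+n u<m) ,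
  (All.tabulate (λ {y} y∈ m≡y → <-All⇒∉ u<m (subst (_∈ u) (sym m≡y) y∈)) ∷ uu)

IsPerm-∷⁻ : ∀ {m u} → IsPerm (suc m) (m ∷ u) → IsPerm m u
IsPerm-∷⁻ (len , (_ ∷ u<1+m) , (m∉u ∷ uu)) =
  ℕP.suc-injective len ,
  All.tabulate (λ y∈ → <suc∧≢⇒< (All.lookup u<1+m y∈) (λ y≡m → All.lookup m∉u y∈ (sym y≡m))) , uu

IsPerm⇒max∈ : ∀ {m l} → IsPerm (suc m) l → m ∈ l
IsPerm⇒max∈ {m} {l} (len , l<1+m , u) with m ∈? l
... | yes m∈l = m∈l
... | no m∉l = ⊥-elim (ℕP.<-irrefl refl (subst (_≤ m) len (Unique∧All<⇒length≤ m l u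
      (All.tabulate (λ {y} y∈ → <suc∧≢⇒< (All.lookup l<1+m y∈) (λ y≡m → m∉l (subst (_∈ l) y≡m y∈)))))))

perms-unique : ∀ m → Unique (perms m)
perms-unique m = UniqueP.map⁺ word-injective (UniqueP.filter⁺ _ (words-unique m (UniqueP.allFin⁺ m)))

∈-perms⁻ : ∀ {m l} → l ∈ perms m → IsPerm m l
∈-perms⁻ {m} l∈ with ∈-map⁻ word l∈
... | v , v∈ , refl with ∈-filter⁻ _ {xs = words (allFin m) m} v∈
... | _ , uv = trans (LP.length-map toℕ (toList v)) (VP.length-toList v) ,
               AllP.map⁺ (All.tabulate (λ {f} _ → FinP.toℕ<n f)) ,
               UniqueP.map⁺ FinP.toℕ-injective uv

toVec< : ∀ {m} (l : List ℕ) → All (_< m) l → (k : ℕ) → length l ≡ k → Vec (Fin m) k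
toVec< [] [] zero _ = V.[]
toVec< (x ∷ l) (x<m ∷ l<m) (suc k) len = fromℕ< x<m V.∷ toVec< l l<m k (ℕP.suc-injective len)

word-toVec< : ∀ {m} (l : List ℕ) (l<m : All (_< m) l) k (len : length l ≡ k) →
  map toℕ (toList (toVec< l l<m k len)) ≡ l
word-toVec< [] [] zero _ = refl
word-toVec< (x ∷ l) (x<m ∷ l<m) (suc k) len =
  cong₂ _∷_ (FinP.toℕ-fromℕ< x<m) (word-toVec< l l<m k (ℕP.suc-injective len))

∈-perms⁺ : ∀ {m l} → IsPerm m l → l ∈ perms m
∈-perms⁺ {m} {l} (len , l<m , u) = subst (_∈ perms m) word-v≡l (∈-map⁺ word v∈Sym)
  where
  v = toVec< l l<m m len
  word-v≡l = word-toVec< l l<m m len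
  v∈Sym : v ∈ Sym m
  v∈Sym = ∈-filter⁺ _ (∈-words ∈-allFin v) (UniqueP.map⁻ (subst Unique (sym word-v≡l) u))

-- With (take, drop) the words front j u ++ m ∷ back j u are the insertions of m into u;
-- with (drop, take) they are the rotations of m ∷ u.
module MaxInsertion
  (front back : ℕ → List ℕ → List ℕ)
  (front++back↭ : ∀ j u → front j u ++ back j u ↭ u)
  (split-injective : ∀ {j j' u u'} → j ≤ length u → j' ≤ length u' →
                     front j u ≡ front j' u' → back j u ≡ back j' u' → u ≡ u' × j ≡ j')
  (split-surjective : ∀ p s → Σ ℕ λ j → Σ (List ℕ) λ u →
                      u ↭ p ++ s × j ≤ length u × front j u ≡ p × back j u ≡ s)
  where

  insertions : ℕ → List ℕ → List (List ℕ)
  insertions m u = map (λ j → front j u ++ m ∷ back j u) (upTo (suc m))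

  allInsertions : ℕ → List (List ℕ)
  allInsertions m = concatMap (insertions m) (perms m)

  ∈-front⇒∈ : ∀ {x j u} → x ∈ front j u → x ∈ u
  ∈-front⇒∈ {j = j} {u} x∈ = PermP.∈-resp-↭ (front++back↭ j u) (∈-++⁺ˡ x∈)

  insertion-injective : ∀ {m j j' u u'} → IsPerm m u → IsPerm m u' → j < suc m → j' < suc m →
    front j u ++ m ∷ back j u ≡ front j' u' ++ m ∷ back j' u' → u ≡ u' × j ≡ j'
  insertion-injective {j = j} {j'} {u} {u'} (len , u<m , _) (len' , u'<m , _) j<1+m j'<1+m eq
    with ++-∷-injective (front j u) (front j' u')
           (<-All⇒∉ u<m ∘ ∈-front⇒∈) (<-All⇒∉ u'<m ∘ ∈-front⇒∈) eq
  ... | front≡ , back≡ = split-injective (subst (j ≤_) (sym len) (ℕP.≤-pred j<1+m))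
                                         (subst (j' ≤_) (sym len') (ℕP.≤-pred j'<1+m)) front≡ back≡

  allInsertions-unique : ∀ m → Unique (allInsertions m)
  allInsertions-unique m = Unique-concatMap (insertions m) (perms-unique m)
    (λ u∈ → Unique-map-injectiveOn _
      (λ p q eq → proj₂ (insertion-injective (∈-perms⁻ u∈) (∈-perms⁻ u∈) (∈-upTo⁻ p) (∈-upTo⁻ q) eq))
      (UniqueP.upTo⁺ (suc m)))
    disjoint
    where
    disjoint : ∀ {u u' z} → u ∈ perms m → u' ∈ perms m → z ∈ insertions m u → z ∈ insertions m u' → u ≡ u'
    disjoint u∈ u'∈ z∈ z∈' with ∈-map⁻ _ z∈ | ∈-map⁻ _ z∈'
    ... | j , j∈ , z≡ | j' , j'∈ , z≡' =
      proj₁ (insertion-injective (∈-perms⁻ u∈) (∈-perms⁻ u'∈) (∈-upTo⁻ j∈) (∈-upTo⁻ j'∈) (trans (sym z≡) z≡'))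

  ∈-allInsertions⁻ : ∀ {m l} → l ∈ allInsertions m → IsPerm (suc m) l
  ∈-allInsertions⁻ {m} l∈ with find (∈-concatMap⁻ (insertions m) {xs = perms m} l∈)
  ... | u , u∈ , l∈ins with ∈-map⁻ _ l∈ins
  ... | j , _ , refl = IsPerm-resp-↭
          (↭-sym (↭-trans (PermP.shift m (front j u) (back j u)) (Perm.prep m (front++back↭ j u))))
          (IsPerm-∷ (∈-perms⁻ u∈))

  ∈-allInsertions⁺ : ∀ {m l} → IsPerm (suc m) l → l ∈ allInsertions m
  ∈-allInsertions⁺ {m} perm-l with ∈-∃++ (IsPerm⇒max∈ perm-l)
  ... | p , s , refl with split-surjective p s
  ... | j , u , u↭ , j≤ , refl , refl =
    ∈-concatMap⁺ (insertions m) (lose (∈-perms⁺ perm-u)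
      (∈-map⁺ (λ j → front j u ++ m ∷ back j u) (∈-upTo⁺ (s≤s (subst (j ≤_) (proj₁ perm-u) j≤)))))
    where
    perm-u : IsPerm m u
    perm-u = IsPerm-resp-↭ (↭-sym u↭) (IsPerm-∷⁻ (IsPerm-resp-↭ (PermP.shift m p s) perm-l))

  allInsertions-↭-perms : ∀ m → allInsertions m ↭ perms (suc m)
  allInsertions-↭-perms m = ∼bag⇒↭ (unique∧set⇒bag (allInsertions-unique m) (perms-unique (suc m))
    (mk⇔ (∈-perms⁺ ∘ ∈-allInsertions⁻) (∈-allInsertions⁺ ∘ ∈-perms⁻)))

take-length-++ : ∀ (p s : List X) → take (length p) (p ++ s) ≡ p
take-length-++ [] s = refl
take-length-++ (a ∷ p) s = cong (a ∷_) (take-length-++ p s)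

drop-length-++ : ∀ (p s : List X) → drop (length p) (p ++ s) ≡ s
drop-length-++ [] s = refl
drop-length-++ (a ∷ p) s = drop-length-++ p s

length-take-≤ : ∀ {j} (u : List X) → j ≤ length u → length (take j u) ≡ j
length-take-≤ {j = j} u j≤ = trans (LP.length-take j u) (ℕP.m≤n⇒m⊓n≡m j≤)

take-drop-injective : ∀ {j j'} {u u' : List X} → j ≤ length u → j' ≤ length u' →
  take j u ≡ take j' u' → drop j u ≡ drop j' u' → u ≡ u' × j ≡ j'
take-drop-injective {j = j} {j'} {u} {u'} j≤ j'≤ take≡ drop≡ =
  trans (sym (LP.take++drop≡id j u)) (trans (cong₂ _++_ take≡ drop≡) (LP.take++drop≡id j' u')) ,
  trans (sym (length-take-≤ u j≤)) (trans (cong length take≡) (length-take-≤ u' j'≤))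

module Insertion = MaxInsertion take drop
  (λ j u → ↭-reflexive (LP.take++drop≡id j u))
  take-drop-injective
  (λ p s → length p , p ++ s , ↭-refl , LP.length-++-≤ˡ p , take-length-++ p s , drop-length-++ p s)

module Rotation = MaxInsertion drop take
  (λ j u → ↭-trans (PermP.++-comm (drop j u) (take j u)) (↭-reflexive (LP.take++drop≡id j u)))
  (λ j≤ j'≤ drop≡ take≡ → take-drop-injective j≤ j'≤ take≡ drop≡)
  (λ p s → length s , s ++ p , PermP.++-comm s p , LP.length-++-≤ˡ s , drop-length-++ s p , take-length-++ s p)

cdesL : List ℕ → ℕ
cdesL l = desL l +ℕ wrapL l

lastOr-∷ʳ : ∀ b r a → lastOr b (r ++ [ a ]) ≡ a
lastOr-∷ʳ b [] a = refl
lastOr-∷ʳ b (c ∷ r) a = lastOr-∷ʳ c r a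

lastOr-∈ : ∀ b r → lastOr b r ∈ b ∷ r
lastOr-∈ b [] = here refl
lastOr-∈ b (c ∷ r) = there (lastOr-∈ c r)

desL-∷ʳ : ∀ b r a → desL (b ∷ r ++ [ a ]) ≡ desL (b ∷ r) +ℕ 𝟙 (a <ᵇ lastOr b r)
desL-∷ʳ b [] a = ℕP.+-identityʳ _
desL-∷ʳ b (c ∷ r) a = trans (cong (𝟙 (c <ᵇ b) +ℕ_) (desL-∷ʳ c r a)) (sym (ℕP.+-assoc (𝟙 (c <ᵇ b)) _ _))

cdesL-rotate : ∀ a r → cdesL (a ∷ r) ≡ cdesL (r ++ [ a ])
cdesL-rotate a [] = refl
cdesL-rotate a (b ∷ r) rewrite desL-∷ʳ b r a | lastOr-∷ʳ b r a =
  trans (ℕP.+-assoc (𝟙 (b <ᵇ a)) (desL (b ∷ r)) _) (ℕP.+-comm (𝟙 (b <ᵇ a)) _)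

cdesL-++-comm : ∀ p s → cdesL (p ++ s) ≡ cdesL (s ++ p)
cdesL-++-comm [] s = cong cdesL (sym (LP.++-identityʳ s))
cdesL-++-comm (a ∷ p) s = begin
  cdesL (a ∷ (p ++ s))       ≡⟨ cdesL-rotate a (p ++ s) ⟩
  cdesL ((p ++ s) ++ [ a ])  ≡⟨ cong cdesL (LP.++-assoc p s [ a ]) ⟩
  cdesL (p ++ (s ++ [ a ]))  ≡⟨ cdesL-++-comm p (s ++ [ a ]) ⟩
  cdesL ((s ++ [ a ]) ++ p)  ≡⟨ cong cdesL (LP.++-assoc s [ a ] p) ⟩
  cdesL (s ++ a ∷ p)         ∎
  where open ≡-Reasoning

cdesL-max-∷ : ∀ m b r → All (_< m) (b ∷ r) → cdesL (m ∷ b ∷ r) ≡ suc (desL (b ∷ r))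
cdesL-max-∷ m b r (b<m ∷ r<m)
  rewrite <⇒<ᵇ≡true b<m | >⇒<ᵇ≡false (All.lookup (b<m ∷ r<m) (lastOr-∈ b r)) = ℕP.+-identityʳ _

cdesL-rotation : ∀ m b r j → All (_< m) (b ∷ r) →
  cdesL (drop j (b ∷ r) ++ m ∷ take j (b ∷ r)) ≡ suc (desL (b ∷ r))
cdesL-rotation m b r j u<m = begin
  cdesL (drop j u ++ m ∷ take j u)    ≡⟨ cdesL-++-comm (drop j u) (m ∷ take j u) ⟩
  cdesL (m ∷ (take j u ++ drop j u))  ≡⟨ cong (cdesL ∘ (m ∷_)) (LP.take++drop≡id j u) ⟩
  cdesL (m ∷ u)                       ≡⟨ cdesL-max-∷ m b r u<m ⟩
  suc (desL u)                        ∎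
  where
  open ≡-Reasoning
  u = b ∷ r

count : (X → ℕ) → ℕ → List X → ℕ
count h i xs = length (filter (λ x → h x ℕ.≟ i) xs)

count-∷ : ∀ (h : X → ℕ) i x xs → count h i (x ∷ xs) ≡ 𝟙 (h x ℕ.≡ᵇ i) +ℕ count h i xs
count-∷ h i x xs with h x ℕ.≡ᵇ i
... | true = refl
... | false = refl

count-map : ∀ (h : Y → ℕ) (f : X → Y) i xs → count h i (map f xs) ≡ count (h ∘ f) i xs
count-map h f i [] = refl
count-map h f i (x ∷ xs) with h (f x) ℕ.≡ᵇ i
... | true = cong suc (count-map h f i xs)
... | false = count-map h f i xs

count-↭ : ∀ (h : X → ℕ) i {xs ys} → xs ↭ ys → count h i xs ≡ count h i ys
count-↭ h i p = PermP.↭-length (PermP.filter-↭ (λ x → h x ℕ.≟ i) p)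

count-const : ∀ (h : X → ℕ) c i xs → (∀ {x} → x ∈ xs → h x ≡ c) → count h i xs ≡ length xs *ℕ 𝟙 (c ℕ.≡ᵇ i)
count-const h c i [] _ = refl
count-const h c i (x ∷ xs) h≡c rewrite h≡c (here refl) with c ℕ.≡ᵇ i | count-const h c i xs (h≡c ∘ there)
... | true | ih = cong suc ih
... | false | ih = ih

count-concatMap-const : ∀ (h : Y → ℕ) (d : X → ℕ) (f : X → List Y) K i xs →
  (∀ {x} → x ∈ xs → length (f x) ≡ K) → (∀ {x y} → x ∈ xs → y ∈ f x → h y ≡ d x) →
  count h i (concatMap f xs) ≡ K *ℕ count d i xs
count-concatMap-const h d f K i [] _ _ = sym (ℕP.*-zeroʳ K)
count-concatMap-const h d f K i (x ∷ xs) len h≡d = begin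
  count h i (f x ++ concatMap f xs)
    ≡⟨ cong length (LP.filter-++ (λ y → h y ℕ.≟ i) (f x) (concatMap f xs)) ⟩
  length (filter (λ y → h y ℕ.≟ i) (f x) ++ filter (λ y → h y ℕ.≟ i) (concatMap f xs))
    ≡⟨ LP.length-++ (filter (λ y → h y ℕ.≟ i) (f x)) ⟩
  count h i (f x) +ℕ count h i (concatMap f xs)
    ≡⟨ cong₂ _+ℕ_ (count-const h (d x) i (f x) (h≡d (here refl)))
                  (count-concatMap-const h d f K i xs (len ∘ there) (h≡d ∘ there)) ⟩
  length (f x) *ℕ 𝟙 (d x ℕ.≡ᵇ i) +ℕ K *ℕ count d i xs
    ≡⟨ cong (λ k → k *ℕ 𝟙 (d x ℕ.≡ᵇ i) +ℕ K *ℕ count d i xs) (len (here refl)) ⟩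
  K *ℕ 𝟙 (d x ℕ.≡ᵇ i) +ℕ K *ℕ count d i xs
    ≡⟨ ℕP.*-distribˡ-+ K (𝟙 (d x ℕ.≡ᵇ i)) (count d i xs) ⟨
  K *ℕ (𝟙 (d x ℕ.≡ᵇ i) +ℕ count d i xs)
    ≡⟨ cong (K *ℕ_) (count-∷ d i x xs) ⟨
  K *ℕ count d i (x ∷ xs) ∎
  where open ≡-Reasoning

𝟙-≡ᵇ-refl : ∀ a → 𝟙 (a ℕ.≡ᵇ a) ≡ 1
𝟙-≡ᵇ-refl a = cong 𝟙 (Equivalence.to T-≡ (ℕP.≡⇒≡ᵇ a a refl))

𝟙-≡ᵇ-≢ : ∀ {a b} → a ≢ b → 𝟙 (a ℕ.≡ᵇ b) ≡ 0
𝟙-≡ᵇ-≢ {a} {b} a≢b with a ℕ.≡ᵇ b in eq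
... | false = refl
... | true = ⊥-elim (a≢b (ℕP.≡ᵇ⇒≡ a b (subst T (sym eq) tt)))

∑-𝟙 : ∀ (h : ℕ → ℚ) {a} I → Unique I → a ∈ I → ∑ (λ i → fromℕ (𝟙 (a ℕ.≡ᵇ i)) * h i) I ≡ h a
∑-𝟙 h (a ∷ I) (a∉I ∷ _) (here refl) = begin
  fromℕ (𝟙 (a ℕ.≡ᵇ a)) * h a + ∑ (λ i → fromℕ (𝟙 (a ℕ.≡ᵇ i)) * h i) I
    ≡⟨ cong₂ (λ k s → fromℕ k * h a + s) (𝟙-≡ᵇ-refl a)
             (∑-zero I (λ {j} j∈ → trans (cong (λ k → fromℕ k * h j) (𝟙-≡ᵇ-≢ (All.lookup a∉I j∈))) (ℚP.*-zeroˡ (h j)))) ⟩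
  1ℚ * h a + 0ℚ
    ≡⟨ solve 1 (λ x → con 1ℚ :* x :+ con 0ℚ := x) refl (h a) ⟩
  h a ∎
  where open ≡-Reasoning
∑-𝟙 h {a} (i ∷ I) (i∉I ∷ uI) (there a∈I) = begin
  fromℕ (𝟙 (a ℕ.≡ᵇ i)) * h i + ∑ (λ j → fromℕ (𝟙 (a ℕ.≡ᵇ j)) * h j) I
    ≡⟨ cong₂ (λ k s → fromℕ k * h i + s) (𝟙-≡ᵇ-≢ (λ a≡i → All.lookup i∉I a∈I (sym a≡i))) (∑-𝟙 h I uI a∈I) ⟩
  0ℚ * h i + h a
    ≡⟨ solve 2 (λ x y → con 0ℚ :* x :+ y := y) refl (h i) (h a) ⟩
  h a ∎
  where open ≡-Reasoning

∑-count : ∀ (φ : X → ℕ) (h : ℕ → ℚ) I xs → Unique I → (∀ {x} → x ∈ xs → φ x ∈ I) →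
  ∑ (λ i → fromℕ (count φ i xs) * h i) I ≡ ∑ (h ∘ φ) xs
∑-count φ h I [] _ _ = ∑-zero I (λ {i} _ → ℚP.*-zeroˡ (h i))
∑-count φ h I (x ∷ xs) uI φ∈I = begin
  ∑ (λ i → fromℕ (count φ i (x ∷ xs)) * h i) I
    ≡⟨ ∑-cong I (λ {i} _ → split i) ⟩
  ∑ (λ i → fromℕ (𝟙 (φ x ℕ.≡ᵇ i)) * h i + fromℕ (count φ i xs) * h i) I
    ≡⟨ ∑-+ (λ i → fromℕ (𝟙 (φ x ℕ.≡ᵇ i)) * h i) (λ i → fromℕ (count φ i xs) * h i) I ⟩
  ∑ (λ i → fromℕ (𝟙 (φ x ℕ.≡ᵇ i)) * h i) I + ∑ (λ i → fromℕ (count φ i xs) * h i) I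
    ≡⟨ cong₂ _+_ (∑-𝟙 h I uI (φ∈I (here refl))) (∑-count φ h I xs uI (φ∈I ∘ there)) ⟩
  h (φ x) + ∑ (h ∘ φ) xs ∎
  where
  open ≡-Reasoning
  split : ∀ i → fromℕ (count φ i (x ∷ xs)) * h i ≡ fromℕ (𝟙 (φ x ℕ.≡ᵇ i)) * h i + fromℕ (count φ i xs) * h i
  split i = trans (cong (λ k → fromℕ k * h i) (count-∷ φ i x xs))
    (trans (cong (_* h i) (fromℕ-+ (𝟙 (φ x ℕ.≡ᵇ i)) (count φ i xs)))
      (ℚP.*-distribʳ-+ (h i) (fromℕ (𝟙 (φ x ℕ.≡ᵇ i))) (fromℕ (count φ i xs))))

B≡n*A : ∀ m i → B (suc (suc m)) i ≡ suc (suc m) *ℕ A (suc m) i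
B≡n*A m i = begin
  B (suc (suc m)) i                                   ≡⟨ count-map cdesL word i (Sym (suc (suc m))) ⟨
  count cdesL i (perms (suc (suc m)))                 ≡⟨ count-↭ cdesL i (Rotation.allInsertions-↭-perms (suc m)) ⟨
  count cdesL i (Rotation.allInsertions (suc m))      ≡⟨ count-concatMap-const cdesL (suc ∘ desL) (Rotation.insertions (suc m))
                                                           (suc (suc m)) i (perms (suc m)) length-insertions cdesL-insertion ⟩
  suc (suc m) *ℕ count (suc ∘ desL) i (perms (suc m)) ≡⟨ cong (suc (suc m) *ℕ_) (count-map (suc ∘ desL) word i (Sym (suc m))) ⟩
  suc (suc m) *ℕ A (suc m) i                          ∎
  where
  open ≡-Reasoning
  length-insertions : ∀ {u} → u ∈ perms (suc m) → length (Rotation.insertions (suc m) u) ≡ suc (suc m)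
  length-insertions _ = trans (LP.length-map _ (upTo (suc (suc m)))) (LP.length-upTo (suc (suc m)))
  cdesL-insertion : ∀ {u v} → u ∈ perms (suc m) → v ∈ Rotation.insertions (suc m) u → cdesL v ≡ suc (desL u)
  cdesL-insertion {u} u∈ v∈ with ∈-perms⁻ u∈
  cdesL-insertion {b ∷ r} _ v∈ | _ , u<1+m , _
    with ∈-map⁻ (λ j → drop j (b ∷ r) ++ suc m ∷ take j (b ∷ r)) {xs = upTo (suc (suc m))} v∈
  ... | j , _ , refl = cdesL-rotation (suc m) b r j u<1+m

worpitzky : ∀ x m → ∑ (λ u → worpitzkyArg x (suc m) (suc (desL u)) ^↓ m) (perms m) ≡ x ^ℚ m * fromℕ (m !)
worpitzky x zero = refl
worpitzky x (suc m) = begin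
  ∑ φ (perms (suc m))
    ≡⟨ ∑-↭ φ (Insertion.allInsertions-↭-perms m) ⟨
  ∑ φ (Insertion.allInsertions m)
    ≡⟨ ∑-concatMap φ (Insertion.insertions m) (perms m) ⟩
  ∑ (∑ φ ∘ Insertion.insertions m) (perms m)
    ≡⟨ ∑-cong (perms m) ∑-insertions ⟩
  ∑ (λ u → fromℕ (suc m) * x * ψ u) (perms m)
    ≡⟨ ∑-*ˡ ψ (fromℕ (suc m) * x) (perms m) ⟨
  fromℕ (suc m) * x * ∑ ψ (perms m)
    ≡⟨ cong (fromℕ (suc m) * x *_) (worpitzky x m) ⟩
  fromℕ (suc m) * x * (x ^ℚ m * fromℕ (m !))
    ≡⟨ solve 4 (λ s x p f → s :* x :* (p :* f) := x :* p :* (s :* f)) refl (fromℕ (suc m)) x (x ^ℚ m) (fromℕ (m !)) ⟩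
  x ^ℚ suc m * (fromℕ (suc m) * fromℕ (m !))
    ≡⟨ cong (x ^ℚ suc m *_) (fromℕ-* (suc m) (m !)) ⟨
  x ^ℚ suc m * fromℕ (suc m !) ∎
  where
  open ≡-Reasoning
  g : ℕ → ℚ
  g k = worpitzkyArg x (suc (suc m)) (suc k) ^↓ suc m
  φ ψ : List ℕ → ℚ
  φ = g ∘ desL
  ψ u = worpitzkyArg x (suc m) (suc (desL u)) ^↓ m
  ∑-insertions : ∀ {u} → u ∈ perms m → ∑ φ (Insertion.insertions m u) ≡ fromℕ (suc m) * x * ψ u
  ∑-insertions {u} u∈ with ∈-perms⁻ u∈
  ... | len , u<m , _ = begin
    ∑ φ (Insertion.insertions m u)                        ≡⟨ ∑-map φ (λ j → insertAt j m u) (upTo (suc m)) ⟩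
    ∑ (λ j → g (desL (insertAt j m u))) (upTo (suc m))    ≡⟨ cong (λ l → ∑ (λ j → g (desL (insertAt j m u))) (upTo (suc l))) len ⟨
    ∑ (λ j → g (desL (insertAt j m u))) (upTo (suc (length u)))
                                                          ≡⟨ ∑-insertAt-desL g m u u<m ⟩
    eulerSplit g (desL u) (length u)                      ≡⟨ cong (eulerSplit g (desL u)) len ⟩
    eulerSplit g (desL u) m                               ≡⟨ eulerSplit-worpitzky x m (desL u) (subst (desL u ≤_) len (desL-≤ u)) ⟩
    fromℕ (suc m) * x * ψ u                               ∎

worpitzky-A : ∀ x m → x ^ℚ suc m ≡ sumFrom1 (suc m) (λ i → fromℕ (A (suc m) i) * binom (worpitzkyArg x (suc (suc m)) i) (suc m))
worpitzky-A x m = sym (begin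
  ∑ (λ i → fromℕ (A (suc m) i) * binom (arg i) (suc m)) I
    ≡⟨ ∑-cong I (λ {i} _ → cong (λ k → fromℕ k * binom (arg i) (suc m)) (count-map (suc ∘ desL) word i (Sym (suc m)))) ⟨
  ∑ (λ i → fromℕ (count (suc ∘ desL) i (perms (suc m))) * binom (arg i) (suc m)) I
    ≡⟨ ∑-count (suc ∘ desL) (λ i → binom (arg i) (suc m)) I (perms (suc m)) I-unique suc-desL∈I ⟩
  ∑ (λ u → arg (suc (desL u)) ^↓ suc m * c) (perms (suc m))
    ≡⟨ ∑-*ʳ (λ u → arg (suc (desL u)) ^↓ suc m) c (perms (suc m)) ⟨
  ∑ (λ u → arg (suc (desL u)) ^↓ suc m) (perms (suc m)) * c
    ≡⟨ cong (_* c) (worpitzky x (suc m)) ⟩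
  x ^ℚ suc m * fromℕ (suc m !) * c
    ≡⟨ ℚP.*-assoc (x ^ℚ suc m) (fromℕ (suc m !)) c ⟩
  x ^ℚ suc m * (fromℕ (suc m !) * c)
    ≡⟨ cong (x ^ℚ suc m *_) (fromℕ-*-inverseʳ (suc m !) {{suc m !≢0}}) ⟩
  x ^ℚ suc m * 1ℚ
    ≡⟨ ℚP.*-identityʳ (x ^ℚ suc m) ⟩
  x ^ℚ suc m ∎)
  where
  open ≡-Reasoning
  arg : ℕ → ℚ
  arg = worpitzkyArg x (suc (suc m))
  I : List ℕ
  I = map suc (upTo (suc m))
  c : ℚ
  c = (+ 1 / (suc m !)) {{suc m !≢0}}
  I-unique : Unique I
  I-unique = UniqueP.map⁺ ℕP.suc-injective (UniqueP.upTo⁺ (suc m))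
  suc-desL∈I : ∀ {u} → u ∈ perms (suc m) → suc (desL u) ∈ I
  suc-desL∈I u∈ with ∈-perms⁻ u∈
  suc-desL∈I {b ∷ r} _ | len , _ = ∈-map⁺ suc (∈-upTo⁺ (s≤s (subst (desL (b ∷ r) ≤_) (ℕP.suc-injective len) (desL-∷-≤ b r))))

mainTheorem2 : (n : ℕ) → .{{_ : NonZero n}} → 2 ≤ n →
    ((x : ℚ) → x ^ℚ (n ∸ 1)
    ≡ sumFrom1 (n ∸ 1) (λ i → ((+ B n i) / n) * binom (fromℕ n + x - fromℕ i - fromℕ 1) (n ∸ 1)))
    × ((i : ℕ) → B n i ≡ n *ℕ A (n ∸ 1) i)
mainTheorem2 (suc (suc m)) (s≤s (s≤s z≤n)) = worpitzky-B , B≡n*A m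
  where
  worpitzky-B : ∀ x → x ^ℚ suc m ≡ sumFrom1 (suc m) (λ i → (+ B (2 +ℕ m) i / (2 +ℕ m)) * binom (worpitzkyArg x (2 +ℕ m) i) (suc m))
  worpitzky-B x = trans (worpitzky-A x m) (∑-cong (map suc (upTo (suc m))) (λ {i} _ →
    cong (_* binom (worpitzkyArg x (2 +ℕ m) i) (suc m))
      (sym (trans (cong (λ k → + k / (2 +ℕ m)) (B≡n*A m i)) ([n*a]/n≡fromℕ-a (2 +ℕ m) (A (suc m) i))))))
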